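{- Let $1\le k<n$ and $I,J\in V_{k,n}$, and let $P_1,\dots,P_d$ be the connected components of $F_I\triangle F_J$, labelled so that for $i<j$ every $(a,b)\in P_i$ and $(a',b')\in P_j$ satisfy $a\le a'$ and $b\le b'$. Let $X,Y\in V_{k,n}$ be such that $\chi_X,\chi_Y$ are vertices of the minimal face $\mathcal{F}(I,J)$ of $\mathcal{O}_{k,n}$ containing $\chi_I,\chi_J$, and write $\chi_X=\chi_{F_I\cap F_J}+\sum_i(\alpha_X)_i\chi_{P_i}$, $\chi_Y=\chi_{F_I\cap F_J}+\sum_i(\alpha_Y)_i\chi_{P_i}$ with $\alpha_X,\alpha_Y\in\{0,1\}^d$. Then (1) $X$ and $Y$ are nonnesting if and only if one of $\alpha_X,\alpha_Y$ is coordinatewise smaller than or equal to the other; (2) $X$ and $Y$ are noncrossing if and only if, on the set of coordinates where $\alpha_X$ and $\alpha_Y$ differ (listed in increasing order), the values of $\alpha_X$ alternate between $0$ and $1$.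
   Context: $V_{k,n}$ is the set of strictly increasing vectors $(i_1,\dots,i_k)$ with entries in $[n]$. $P_{k,n}=[k]\times[n-k]$ with $(a,b)\le(a',b')$ iff $a\ge a'$ and $b\le b'$. To $I$ corresponds the order filter $F_I=\{(a,b): i_a\le a+b-1\}$ with characteristic vector $\chi_I$; $\mathcal{O}_{k,n}=\mathrm{conv}\{\chi_I:I\in V_{k,n}\}$ is the order polytope of $P_{k,n}$. Components are connected components of the comparability graph. The face $\mathcal{F}(I,J)$ is a combinatorial $d$-cube whose vertices are $\chi_{F_I\cap F_J}+\sum_i\alpha_i\chi_{P_i}$, $\alpha\in\{0,1\}^d$. Arcs $(p<p')$, $(q<q')$ nest if $p<q<q'<p'$ or $q<p<p'<q'$, and cross if $p<q<p'<q'$ or $q<p<q'<p'$. $X,Y$ are nonnesting if for all $a<b$ the arcs $(x_a<x_b)$, $(y_a<y_b)$ do not nest; noncrossing if for all $a<b$ with $x_\ell=y_\ell$ for all $a<\ell<b$ these arcs do not cross. -}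

module Defs where

open import Data.Nat as ℕ using (ℕ; zero; suc; _+_; _*_; _∸_; _≤ᵇ_)
open import Data.Fin as Fin using (Fin; toℕ)
open import Data.Bool as Bool using (Bool; true; false; if_then_else_; _∧_; _xor_)
open import Data.Product using (Σ; ∃; _×_; _,_; proj₁; proj₂)
open import Data.Sum using (_⊎_)
open import Data.List using (tabulate)
open import Data.Nat.ListAction using (sum)
open import Relation.Binary.PropositionalEquality using (_≡_; _≢_)
open import Relation.Nullary using (¬_)

-- 1-based indices are encoded by Fin with 0-based values:
-- the element (a , b) of Fin k × Fin (n ∸ k) stands for (toℕ a + 1 , toℕ b + 1).

InV : (k n : ℕ) → (Fin k → ℕ) → Set
InV k n I = (∀ a → 1 ℕ.≤ I a × I a ℕ.≤ n) × (∀ a b → a Fin.< b → I a ℕ.< I b)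

Elem : ℕ → ℕ → Set
Elem k n = Fin k × Fin (n ∸ k)

_≼_ : ∀ {k n} → Elem k n → Elem k n → Set
(a , b) ≼ (a' , b') = (a' Fin.≤ a) × (b Fin.≤ b')

Comparable : ∀ {k n} → Elem k n → Elem k n → Set
Comparable x y = x ≼ y ⊎ y ≼ x

Subset : ℕ → ℕ → Set
Subset k n = Elem k n → Bool

-- the order filter F_I = {(a,b) : i_a ≤ a + b - 1}  (a, b 1-based)
F : ∀ {k n} → (Fin k → ℕ) → Subset k n
F I (a , b) = I a ≤ᵇ (suc (toℕ a) + suc (toℕ b) ∸ 1)

_∩_ : ∀ {k n} → Subset k n → Subset k n → Subset k n
(S ∩ T) x = S x ∧ T x

_△_ : ∀ {k n} → Subset k n → Subset k n → Subset k n
(S △ T) x = S x xor T x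

bit : Bool → ℕ
bit b = if b then 1 else 0

χ : ∀ {k n} → Subset k n → Elem k n → ℕ
χ S x = bit (S x)

data Path {k n} (S : Subset k n) : Elem k n → Elem k n → Set where
  here : ∀ {x} → S x ≡ true → Path S x x
  step : ∀ {x y z} → S x ≡ true → Comparable x y → Path S y z → Path S x z

-- P : Fin d → Subset is exactly the family of connected components of the
-- comparability graph of S (each listed once)
IsComponents : ∀ {k n} (S : Subset k n) (d : ℕ) → (Fin d → Subset k n) → Set
IsComponents S d P =
  (∀ i → ∃ λ x → P i x ≡ true)
  × (∀ i x → P i x ≡ true → S x ≡ true)
  × (∀ x → S x ≡ true → ∃ λ i → P i x ≡ true)
  × (∀ i j x y → P i x ≡ true → P j y ≡ true →
       (Path S x y → i ≡ j) × (i ≡ j → Path S x y))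

IsOrderedComponents : ∀ {k n} (d : ℕ) → (Fin d → Subset k n) → Set
IsOrderedComponents {k} {n} d P =
  ∀ (i j : Fin d) → i Fin.< j → ∀ (x y : Elem k n) → P i x ≡ true → P j y ≡ true →
    (proj₁ x Fin.≤ proj₁ y) × (proj₂ x Fin.≤ proj₂ y)

VertexCoords : ∀ {k n} (d : ℕ) (I J X : Fin k → ℕ) (P : Fin d → Subset k n) →
               (Fin d → Bool) → Set
VertexCoords {k} {n} d I J X P α =
  ∀ (x : Elem k n) →
    χ (F {k} {n} X) x ≡ χ (F I ∩ F J) x + sum (tabulate (λ i → bit (α i) * χ (P i) x))

Nest : ℕ → ℕ → ℕ → ℕ → Set
Nest p p' q q' = (p ℕ.< q × q ℕ.< q' × q' ℕ.< p') ⊎ (q ℕ.< p × p ℕ.< p' × p' ℕ.< q')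

Cross : ℕ → ℕ → ℕ → ℕ → Set
Cross p p' q q' = (p ℕ.< q × q ℕ.< p' × p' ℕ.< q') ⊎ (q ℕ.< p × p ℕ.< q' × q' ℕ.< p')

Nonnesting : ∀ {k} → (Fin k → ℕ) → (Fin k → ℕ) → Set
Nonnesting {k} X Y = ∀ (a b : Fin k) → a Fin.< b → ¬ Nest (X a) (X b) (Y a) (Y b)

Noncrossing : ∀ {k} → (Fin k → ℕ) → (Fin k → ℕ) → Set
Noncrossing {k} X Y =
  ∀ (a b : Fin k) → a Fin.< b →
    (∀ (l : Fin k) → a Fin.< l → l Fin.< b → X l ≡ Y l) →
    ¬ Cross (X a) (X b) (Y a) (Y b)

_≤α_ : ∀ {d} → (Fin d → Bool) → (Fin d → Bool) → Set
α ≤α β = ∀ i → α i Bool.≤ β i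

-- On the coordinates where α and β differ, listed increasingly, the values of α
-- alternate: any two such coordinates i < j with no such coordinate strictly
-- between them carry different α-values.
Alternates : ∀ {d} → (Fin d → Bool) → (Fin d → Bool) → Set
Alternates {d} α β =
  ∀ (i j : Fin d) → i Fin.< j → α i ≢ β i → α j ≢ β j →
    (∀ (l : Fin d) → i Fin.< l → l Fin.< j → α l ≡ β l) →
    α i ≢ α j

module Submission where

open import Defs
open import Data.Nat using (ℕ; _≤_; _<_)
open import Data.Fin using (Fin)
open import Data.Bool using (Bool)
open import Data.Product using (_×_)
open import Data.Sum using (_⊎_)
open import Function.Bundles using (_⇔_)

open import Data.Nat using (zero; suc; _+_; _*_; _∸_; _≤ᵇ_; s≤s; s≤s⁻¹)
open import Data.Nat.Properties
open import Data.Fin as Fin using (toℕ; fromℕ; fromℕ<)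
import Data.Fin.Properties as Finₚ
open import Data.Bool as Bool using (true; false; not; _∧_; _xor_)
import Data.Bool.Properties as Boolₚ
open import Data.Product using (Σ; ∃; _,_; proj₁; proj₂)
open import Data.Sum using (inj₁; inj₂)
open import Data.List using (tabulate)
open import Data.Nat.ListAction using (sum)
open import Data.Empty using (⊥)
open import Function using (_∘_)
open import Function.Bundles using (mk⇔; Equivalence)
open import Relation.Nullary using (¬_; yes; no; contradiction)
open import Relation.Nullary.Decidable using (¬?; _×-dec_; decidable-stable)
open import Relation.Binary.Definitions using (tri<; tri≈; tri>)
open import Relation.Binary.PropositionalEquality

-- For X ∈ V_{k,n}, row r of the order filter F_X consists of the
-- columns c ≥ τ X r, where the threshold τ X r = X r - (r + 1) is weakly
-- increasing in r.  So F_X ∖ F_Y meets row r in the columns [τ X r, τ Y r), and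
-- X r < Y r iff row r contains such "X-only" cells.  A vertex of the face F(I,J)
-- takes the value α_i on the component P_i and agrees with F_I ∩ F_J off
-- F_I △ F_J, so the X-only cells are the cells of the components with α_X = 1,
-- α_Y = 0.  (1) A nesting amounts to a row with X < Y and a row with Y < X, i.e.
-- to coordinates with α_X > α_Y and with α_Y > α_X.  (2) In an upward crossing
-- X a < Y a < X b < Y b the X-only cells of rows a and b lie in components i < j
-- (one component cannot bridge the agreeing rows between a and b) with all
-- components in between unmoved, against alternation; conversely two X-only
-- components i < j with unmoved components in between cross at the closest rows
-- a < b of their cells.  The file develops Boolean vectors and sums, thresholds,
-- increasing vectors, arcs, components, the face and its vertices, the theorem.

bit-injective : ∀ {a b} → bit a ≡ bit b → a ≡ b
bit-injective {true}  {true}  _  = refl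
bit-injective {false} {false} _  = refl
bit-injective {true}  {false} ()
bit-injective {false} {true}  ()

sum-zero : ∀ {d} (f : Fin d → ℕ) → (∀ j → f j ≡ 0) → sum (tabulate f) ≡ 0
sum-zero {zero}  f f≡0 = refl
sum-zero {suc d} f f≡0 =
  cong₂ _+_ (f≡0 Fin.zero) (sum-zero (f ∘ Fin.suc) (f≡0 ∘ Fin.suc))

sum-single : ∀ {d} (f : Fin d → ℕ) (i : Fin d) →
  (∀ j → j ≢ i → f j ≡ 0) → sum (tabulate f) ≡ f i
sum-single {suc d} f Fin.zero off =
  trans (cong (f Fin.zero +_) (sum-zero (f ∘ Fin.suc) (λ j → off (Fin.suc j) λ ())))
        (+-identityʳ (f Fin.zero))
sum-single {suc d} f (Fin.suc i) off =
  trans (cong (_+ sum (tabulate (f ∘ Fin.suc))) (off Fin.zero λ ()))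
        (sum-single (f ∘ Fin.suc) i (λ j j≢i → off (Fin.suc j) (j≢i ∘ Finₚ.suc-injective)))

xor⇒¬∧ : ∀ a b → a xor b ≡ true → a ∧ b ≡ false
xor⇒¬∧ true  true  ()
xor⇒¬∧ true  false _ = refl
xor⇒¬∧ false b     _ = refl

differ⇒not : ∀ {a b} → a ≢ b → b ≡ not a
differ⇒not a≢b = Boolₚ.¬-not (a≢b ∘ sym)

bool-≰ : ∀ {a b} → ¬ (a Bool.≤ b) → a ≡ true × b ≡ false
bool-≰ {false} {false} a≰b = contradiction Bool.b≤b a≰b
bool-≰ {false} {true}  a≰b = contradiction Bool.f≤t a≰b
bool-≰ {true}  {true}  a≰b = contradiction Bool.b≤b a≰b
bool-≰ {true}  {false} _   = refl , refl

≤α-or-exceeds : ∀ {d} (α β : Fin d → Bool) →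
  α ≤α β ⊎ ∃ λ i → α i ≡ true × β i ≡ false
≤α-or-exceeds {d} α β with Finₚ.all? (λ i → α i Boolₚ.≤? β i)
... | yes α≤β = inj₁ α≤β
... | no  α≰β with Finₚ.¬∀⟶∃¬ d _ (λ i → α i Boolₚ.≤? β i) α≰β
...   | i , αi≰βi = inj₂ (i , bool-≰ αi≰βi)

≤α⇒¬exceeds : ∀ {d} {α β : Fin d → Bool} {i} → α ≤α β → ¬ (α i ≡ true × β i ≡ false)
≤α⇒¬exceeds {α = α} {β} {i} α≤β (αi , βi) with subst₂ Bool._≤_ αi βi (α≤β i)
... | ()

alternates-sym : ∀ {d} {α β : Fin d → Bool} → Alternates α β → Alternates β α
alternates-sym {α = α} {β} alt i j i<j βi≢αi βj≢αj agree βi≡βj =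
  alt i j i<j (βi≢αi ∘ sym) (βj≢αj ∘ sym) (λ l i<l l<j → sym (agree l i<l l<j))
    (begin
      α i        ≡⟨ differ⇒not βi≢αi ⟩
      not (β i)  ≡⟨ cong not βi≡βj ⟩
      not (β j)  ≡⟨ differ⇒not βj≢αj ⟨
      α j        ∎)
  where open ≡-Reasoning

-- The threshold of row r: F_X meets row r exactly in the columns c ≥ τ X r.
τ : ∀ {k} → (Fin k → ℕ) → Fin k → ℕ
τ X r = X r ∸ suc (toℕ r)

F-true⇔ : ∀ {k n} (X : Fin k → ℕ) (r : Fin k) (c : Fin (n ∸ k)) →
  F {k} {n} X (r , c) ≡ true ⇔ τ X r ≤ toℕ c
F-true⇔ X r c = mk⇔
  (λ member → m≤n+o⇒m∸n≤o (X r) (suc (toℕ r))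
     (subst (X r ≤_) (+-suc (toℕ r) (toℕ c))
       (≤ᵇ⇒≤ (X r) _ (Equivalence.from Boolₚ.T-≡ member))))
  (λ τ≤c → Equivalence.to Boolₚ.T-≡ (≤⇒≤ᵇ
     (subst (X r ≤_) (sym (+-suc (toℕ r) (toℕ c)))
       (≤-trans (m≤n+m∸n (X r) (suc (toℕ r))) (+-monoʳ-≤ (suc (toℕ r)) τ≤c)))))

F-false⇔ : ∀ {k n} (X : Fin k → ℕ) (r : Fin k) (c : Fin (n ∸ k)) →
  F {k} {n} X (r , c) ≡ false ⇔ toℕ c < τ X r
F-false⇔ X r c = mk⇔
  (λ outside → ≰⇒> (λ τ≤c →
     contradiction (trans (sym outside) (Equivalence.from (F-true⇔ X r c) τ≤c)) λ ()))
  (λ c<τ → Boolₚ.¬-not (<⇒≱ c<τ ∘ Equivalence.to (F-true⇔ X r c)))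

XOnly : ∀ {k n} → (Fin k → ℕ) → (Fin k → ℕ) → Elem k n → Set
XOnly X Y (r , c) = τ X r ≤ toℕ c × toℕ c < τ Y r

xonly⇔ : ∀ {k n} (X Y : Fin k → ℕ) (x : Elem k n) →
  XOnly X Y x ⇔ (F X x ≡ true × F Y x ≡ false)
xonly⇔ X Y (r , c) = mk⇔
  (λ (τX≤c , c<τY) → Equivalence.from (F-true⇔ X r c) τX≤c , Equivalence.from (F-false⇔ Y r c) c<τY)
  (λ (inX , notY) → Equivalence.to (F-true⇔ X r c) inX , Equivalence.to (F-false⇔ Y r c) notY)

predecessor : ∀ {k} (b : Fin k) {d} → toℕ b ≡ suc d → Σ (Fin k) λ a → toℕ a ≡ d
predecessor {k} b {d} b≡1+d = fromℕ< d<k , Finₚ.toℕ-fromℕ< d<k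
  where
  d<k : d < k
  d<k = <-trans (n<1+n d) (subst (_< k) b≡1+d (Finₚ.toℕ<n b))

steps⇒monotone : ∀ {k} (f : Fin k → ℕ) →
  (∀ a a' → toℕ a' ≡ suc (toℕ a) → f a ≤ f a') →
  ∀ {a b} → a Fin.≤ b → f a ≤ f b
steps⇒monotone f ascends {a} {b} a≤b = climb (toℕ b ∸ toℕ a) b (sym (m∸n+n≡m a≤b))
  where
  climb : ∀ e b → toℕ b ≡ e + toℕ a → f a ≤ f b
  climb zero    b b≡a = ≤-reflexive (cong f (Finₚ.toℕ-injective (sym b≡a)))
  climb (suc e) b b≡1+e+a with predecessor b b≡1+e+a
  ... | b' , b'≡e+a = ≤-trans (climb e b' b'≡e+a) (ascends b' b (trans b≡1+e+a (cong suc (sym b'≡e+a))))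

lower : ∀ {k n} {X : Fin k → ℕ} → InV k n X → ∀ r → suc (toℕ r) ≤ X r
lower {X = X} inv r = go (toℕ r) r refl
  where
  go : ∀ e r → toℕ r ≡ e → suc e ≤ X r
  go zero    r _       = proj₁ (proj₁ inv r)
  go (suc e) r r≡1+e with predecessor r r≡1+e
  ... | r' , r'≡e = ≤-trans (s≤s (go e r' r'≡e))
                      (proj₂ inv r' r (subst₂ _<_ (sym r'≡e) (sym r≡1+e) (n<1+n e)))

value-τ : ∀ {k n} {X : Fin k → ℕ} → InV k n X → ∀ r → X r ≡ suc (toℕ r) + τ X r
value-τ inv r = sym (m+[n∸m]≡n (lower inv r))

τ-step : ∀ {k} (Y X : Fin k → ℕ) {a a' : Fin k} →
  toℕ a' ≡ suc (toℕ a) → Y a < X a' → τ Y a ≤ τ X a'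
τ-step Y X {a} {a'} a'≡1+a Ya<Xa' =
  subst (λ t → τ Y a ≤ X a' ∸ suc t) (sym a'≡1+a) (∸-monoˡ-≤ (suc (suc (toℕ a))) Ya<Xa')

τ-mono : ∀ {k n} {X : Fin k → ℕ} → InV k n X → ∀ {a b} → a Fin.≤ b → τ X a ≤ τ X b
τ-mono {X = X} inv = steps⇒monotone (τ X)
  (λ a a' a'≡1+a → τ-step X X a'≡1+a (proj₂ inv a a' (≤-reflexive (sym a'≡1+a))))

τ-bounded : ∀ {k n} {X : Fin k → ℕ} → InV k n X → ∀ r → τ X r ≤ n ∸ k
τ-bounded {suc k} {n} {X} inv r = begin
  τ X r                  ≤⟨ τ-mono inv (Finₚ.≤fromℕ r) ⟩
  X last ∸ suc (toℕ last) ≡⟨ cong (λ t → X last ∸ suc t) (Finₚ.toℕ-fromℕ k) ⟩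
  X last ∸ suc k         ≤⟨ ∸-monoˡ-≤ (suc k) (proj₂ (proj₁ inv last)) ⟩
  n ∸ suc k              ∎
  where
  open ≤-Reasoning
  last : Fin (suc k)
  last = fromℕ k

rise⇔ : ∀ {k n} {X Y : Fin k → ℕ} → InV k n X → InV k n Y →
  ∀ r → X r < Y r ⇔ τ X r < τ Y r
rise⇔ invX invY r = mk⇔
  (λ Xr<Yr → +-cancelˡ-< (suc (toℕ r)) _ _
     (subst₂ _<_ (value-τ invX r) (value-τ invY r) Xr<Yr))
  (λ τXr<τYr → subst₂ _<_ (sym (value-τ invX r)) (sym (value-τ invY r))
     (+-monoʳ-< (suc (toℕ r)) τXr<τYr))

τ-order⇒value-order : ∀ {k n} {X Y : Fin k → ℕ} → InV k n X → InV k n Y →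
  ∀ {a b} → a Fin.< b → τ Y a ≤ τ X b → Y a < X b
τ-order⇒value-order invX invY {a} {b} a<b τYa≤τXb =
  subst₂ _<_ (sym (value-τ invY a)) (sym (value-τ invX b)) (+-mono-<-≤ (s≤s a<b) τYa≤τXb)

xonly-cell : ∀ {k n} {X Y : Fin k → ℕ} → InV k n Y → ∀ r {v} → τ X r ≤ v → v < τ Y r →
  Σ (Fin (n ∸ k)) λ c → toℕ c ≡ v × XOnly X Y (r , c)
xonly-cell {X = X} {Y} invY r {v} τX≤v v<τY =
  fromℕ< v<m , c≡v , subst (τ X r ≤_) (sym c≡v) τX≤v , subst (_< τ Y r) (sym c≡v) v<τY
  where
  v<m = <-≤-trans v<τY (τ-bounded invY r)
  c≡v = Finₚ.toℕ-fromℕ< v<m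

rising-cell : ∀ {k n} {X Y : Fin k → ℕ} → InV k n X → InV k n Y →
  ∀ {r} → X r < Y r → Σ (Fin (n ∸ k)) λ c → XOnly X Y (r , c)
rising-cell {X = X} {Y} invX invY {r} Xr<Yr with xonly-cell {X = X} invY r ≤-refl (Equivalence.to (rise⇔ invX invY r) Xr<Yr)
... | c , _ , xonly = c , xonly

differing-cell : ∀ {k n} {X Y : Fin k → ℕ} → InV k n X → InV k n Y →
  ∀ {r} → X r ≢ Y r → Σ (Fin (n ∸ k)) λ c → F {k} {n} X (r , c) ≢ F Y (r , c)
differing-cell {X = X} {Y} invX invY {r} Xr≢Yr with <-cmp (X r) (Y r)
... | tri≈ _ Xr≡Yr _ = contradiction Xr≡Yr Xr≢Yr
... | tri< Xr<Yr _ _ with rising-cell invX invY Xr<Yr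
...   | c , xonly with Equivalence.to (xonly⇔ X Y (r , c)) xonly
...     | inX , notY = c , λ e → contradiction (trans (sym inX) (trans e notY)) λ ()
differing-cell {X = X} {Y} invX invY {r} Xr≢Yr | tri> _ _ Yr<Xr with rising-cell invY invX Yr<Xr
...   | c , xonly with Equivalence.to (xonly⇔ Y X (r , c)) xonly
...     | inY , notX = c , λ e → contradiction (trans (sym inY) (trans (sym e) notX)) λ ()

agree⇒¬xonly : ∀ {k n} {X Y : Fin k → ℕ} {r c} → X r ≡ Y r → ¬ XOnly {k} {n} X Y (r , c)
agree⇒¬xonly {r = r} Xr≡Yr (τX≤c , c<τY) =
  <-irrefl (cong (λ v → v ∸ suc (toℕ r)) Xr≡Yr) (≤-<-trans τX≤c c<τY)

-- For rows a < b with τ Y a ≤ τ X b, an X-only cell in a row ≤ a and an X-only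
-- cell in a row ≥ b are incomparable: the second would lie weakly north-west.
no-bridge : ∀ {k n} {X Y : Fin k → ℕ} → InV k n X → InV k n Y →
  ∀ {a b} {u w : Elem k n} → a Fin.< b → τ Y a ≤ τ X b →
  XOnly X Y u → XOnly X Y w → proj₁ u Fin.≤ a → b Fin.≤ proj₁ w → ¬ Comparable u w
no-bridge invX invY a<b _ _ _ u≤a b≤w (inj₁ (w≤u , _)) =
  <⇒≱ a<b (≤-trans b≤w (≤-trans w≤u u≤a))
no-bridge {X = X} {Y} invX invY {a} {b} {u} {w} a<b τYa≤τXb (_ , cu<τY) (τX≤cw , _) u≤a b≤w
  (inj₂ (_ , cw≤cu)) = <-irrefl refl (begin-strict
    toℕ (proj₂ u)  <⟨ cu<τY ⟩
    τ Y (proj₁ u)  ≤⟨ τ-mono invY u≤a ⟩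
    τ Y a          ≤⟨ τYa≤τXb ⟩
    τ X b          ≤⟨ τ-mono invX b≤w ⟩
    τ X (proj₁ w)  ≤⟨ τX≤cw ⟩
    toℕ (proj₂ w)  ≤⟨ cw≤cu ⟩
    toℕ (proj₂ u)  ∎)
  where open ≤-Reasoning

AgreeBetween : ∀ {k} → (Fin k → ℕ) → (Fin k → ℕ) → Fin k → Fin k → Set
AgreeBetween X Y a b = ∀ l → a Fin.< l → l Fin.< b → X l ≡ Y l

agree-or-differ : ∀ {k} (X Y : Fin k → ℕ) (a b : Fin k) →
  AgreeBetween X Y a b ⊎ Σ (Fin k) λ r → a Fin.< r × r Fin.< b × X r ≢ Y r
agree-or-differ X Y a b
  with Finₚ.any? (λ l → (a Finₚ.<? l) ×-dec (l Finₚ.<? b) ×-dec ¬? (X l ≟ Y l))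
... | yes witness = inj₂ witness
... | no  none    = inj₁ λ l a<l l<b →
        decidable-stable (X l ≟ Y l) (λ Xl≢Yl → none (l , a<l , l<b , Xl≢Yl))

crossing-threshold : ∀ {k n} {X Y : Fin k → ℕ} → InV k n X → InV k n Y →
  ∀ {a b} → a Fin.< b → AgreeBetween X Y a b → Y a < X b → τ Y a ≤ τ X b
crossing-threshold {X = X} {Y} invX invY {a} {b} a<b agree Ya<Xb =
  ≤-trans (τ-step Y X a'≡1+a Ya<Xa') (τ-mono invX a'≤b)
  where
  a' : Fin _
  a' = fromℕ< (≤-<-trans a<b (Finₚ.toℕ<n b))
  a'≡1+a : toℕ a' ≡ suc (toℕ a)
  a'≡1+a = Finₚ.toℕ-fromℕ< _
  a<a' : a Fin.< a'
  a<a' = ≤-reflexive (sym a'≡1+a)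
  a'≤b : a' Fin.≤ b
  a'≤b = subst (_≤ toℕ b) (sym a'≡1+a) a<b
  Ya<Xa' : Y a < X a'
  Ya<Xa' with m≤n⇒m<n∨m≡n a'≤b
  ... | inj₁ a'<b = subst (Y a <_) (sym (agree a' a<a' a'<b)) (proj₂ invY a a' a<a')
  ... | inj₂ a'≡b = subst (λ t → Y a < X t) (sym (Finₚ.toℕ-injective a'≡b)) Ya<Xb

nest⇒opposite-rows : ∀ {k} {X Y : Fin k → ℕ} {a b} → Nest (X a) (X b) (Y a) (Y b) →
  (∃ λ r → X r < Y r) × (∃ λ r → Y r < X r)
nest⇒opposite-rows {a = a} {b} (inj₁ (Xa<Ya , _ , Yb<Xb)) = (a , Xa<Ya) , (b , Yb<Xb)
nest⇒opposite-rows {a = a} {b} (inj₂ (Ya<Xa , _ , Xb<Yb)) = (b , Xb<Yb) , (a , Ya<Xa)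

opposite-rows⇒nest : ∀ {k n} {X Y : Fin k → ℕ} → InV k n X → InV k n Y →
  ∀ {a b} → X a < Y a → Y b < X b → ¬ Nonnesting X Y
opposite-rows⇒nest invX invY {a} {b} Xa<Ya Yb<Xb nonnesting with Finₚ.<-cmp a b
... | tri< a<b _ _ = nonnesting a b a<b (inj₁ (Xa<Ya , proj₂ invY a b a<b , Yb<Xb))
... | tri≈ _ refl _ = <-asym Xa<Ya Yb<Xb
... | tri> _ _ b<a = nonnesting b a b<a (inj₂ (Yb<Xb , proj₂ invX b a b<a , Xa<Ya))

noncrossing-sym : ∀ {k} {X Y : Fin k → ℕ} → Noncrossing X Y → Noncrossing Y X
noncrossing-sym noncrossing a b a<b agree (inj₁ cross) =
  noncrossing a b a<b (λ l a<l l<b → sym (agree l a<l l<b)) (inj₂ cross)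
noncrossing-sym noncrossing a b a<b agree (inj₂ cross) =
  noncrossing a b a<b (λ l a<l l<b → sym (agree l a<l l<b)) (inj₁ cross)

same-row-comparable : ∀ {k n} {r r' : Fin k} {c c' : Fin (n ∸ k)} →
  r ≡ r' → Comparable {k} {n} (r , c) (r' , c')
same-row-comparable {c = c} {c'} refl with ≤-total (toℕ c) (toℕ c')
... | inj₁ c≤c' = inj₁ (≤-refl , c≤c')
... | inj₂ c'≤c = inj₂ (≤-refl , c'≤c)

module Components {k n d} {S : Subset k n} {P : Fin d → Subset k n}
                  (comps : IsComponents S d P) (ord : IsOrderedComponents d P) where

  nonempty : ∀ i → ∃ λ x → P i x ≡ true
  nonempty = proj₁ comps

  inside : ∀ i x → P i x ≡ true → S x ≡ true
  inside = proj₁ (proj₂ comps)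

  cover : ∀ x → S x ≡ true → ∃ λ i → P i x ≡ true
  cover = proj₁ (proj₂ (proj₂ comps))

  joined : ∀ {i j x y} → P i x ≡ true → P j y ≡ true → i ≡ j → Path S x y
  joined {i} {j} {x} {y} px py = proj₂ (proj₂ (proj₂ (proj₂ comps)) i j x y px py)

  path-start : ∀ {x y} → Path S x y → S x ≡ true
  path-start (here sx)     = sx
  path-start (step sx _ _) = sx

  comparable⇒same : ∀ {i j x y} → P i x ≡ true → P j y ≡ true → Comparable x y → i ≡ j
  comparable⇒same {i} {j} {x} {y} px py x~y =
    proj₁ (proj₂ (proj₂ (proj₂ comps)) i j x y px py) (step (inside i x px) x~y (here (inside j y py)))

  component-unique : ∀ {i j x} → P i x ≡ true → P j x ≡ true → i ≡ j
  component-unique {i} {j} {x} pi pj =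
    proj₁ (proj₂ (proj₂ (proj₂ comps)) i j x x pi pj) (here (inside i x pi))

  absorb : ∀ {i x y} → P i x ≡ true → S y ≡ true → Comparable x y → P i y ≡ true
  absorb {i} px sy x~y with cover _ sy
  ... | j , py = subst (λ l → P l _ ≡ true) (sym (comparable⇒same px py x~y)) py

  path-invariant : ∀ {i} (Q : Elem k n → Set) →
    (∀ {u w} → P i u ≡ true → P i w ≡ true → Comparable u w → Q u → Q w) →
    ∀ {u z} → Path S u z → P i u ≡ true → Q u → Q z
  path-invariant Q preserved (here _) pu qu = qu
  path-invariant Q preserved (step _ u~w path) pu qu =
    path-invariant Q preserved path pw (preserved pu pw u~w qu)
    where pw = absorb pu (path-start path) u~w

  rows-ordered : ∀ {i j x y} → i Fin.< j → P i x ≡ true → P j y ≡ true →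
    proj₁ x Fin.< proj₁ y
  rows-ordered {i} {j} {x} {y} i<j px py with m≤n⇒m<n∨m≡n (proj₁ (ord i j i<j x y px py))
  ... | inj₁ x<y   = x<y
  ... | inj₂ x≡y = contradiction
          (comparable⇒same px py (same-row-comparable (Finₚ.toℕ-injective x≡y))) (Finₚ.<⇒≢ i<j)

module Face {k n} (I J : Fin k → ℕ) {d} (P : Fin d → Subset k n)
            (comps : IsComponents (F I △ F J) d P) (ord : IsOrderedComponents d P) where

  open Components comps ord

  module Vertex {X : Fin k → ℕ} {α : Fin d → Bool} (vc : VertexCoords d I J X P α) where

    F-on-component : ∀ {i x} → P i x ≡ true → F X x ≡ α i
    F-on-component {i} {x} px = bit-injective (begin
      bit (F X x)                                                      ≡⟨ vc x ⟩
      bit ((F I ∩ F J) x) + sum (tabulate λ j → bit (α j) * bit (P j x))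
        ≡⟨ cong₂ _+_ (cong bit (xor⇒¬∧ (F I x) (F J x) (inside i x px))) (sum-single _ i off) ⟩
      bit (α i) * bit (P i x)                                          ≡⟨ cong (λ b → bit (α i) * bit b) px ⟩
      bit (α i) * 1                                                    ≡⟨ *-identityʳ _ ⟩
      bit (α i)                                                        ∎)
      where
      open ≡-Reasoning
      off : ∀ j → j ≢ i → bit (α j) * bit (P j x) ≡ 0
      off j j≢i with P j x in pj
      ... | true  = contradiction (component-unique pj px) j≢i
      ... | false = *-zeroʳ (bit (α j))

    F-off-components : ∀ {x} → (F I △ F J) x ≡ false → F X x ≡ (F I ∩ F J) x
    F-off-components {x} x∉S = bit-injective (begin
      bit (F X x)                                                      ≡⟨ vc x ⟩
      bit ((F I ∩ F J) x) + sum (tabulate λ j → bit (α j) * bit (P j x))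
        ≡⟨ cong (bit ((F I ∩ F J) x) +_) (sum-zero _ off) ⟩
      bit ((F I ∩ F J) x) + 0                                          ≡⟨ +-identityʳ _ ⟩
      bit ((F I ∩ F J) x)                                              ∎)
      where
      open ≡-Reasoning
      off : ∀ j → bit (α j) * bit (P j x) ≡ 0
      off j with P j x in pj
      ... | true  = contradiction (trans (sym (inside j x pj)) x∉S) λ ()
      ... | false = *-zeroʳ (bit (α j))

  differ⇒inside : ∀ {X Y αX αY} → VertexCoords d I J X P αX → VertexCoords d I J Y P αY →
    ∀ {x} → F X x ≢ F Y x → (F I △ F J) x ≡ true
  differ⇒inside {X} {Y} {αX} {αY} vcX vcY {x} FX≢FY with (F I △ F J) x in sx
  ... | true  = refl
  ... | false = contradiction
        (trans (Vertex.F-off-components {X} {αX} vcX sx) (sym (Vertex.F-off-components {Y} {αY} vcY sx))) FX≢FY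

  module Pair {X Y : Fin k → ℕ} (invX : InV k n X) (invY : InV k n Y) {αX αY : Fin d → Bool}
              (vcX : VertexCoords d I J X P αX) (vcY : VertexCoords d I J Y P αY) where

    module VX = Vertex {X} {αX} vcX
    module VY = Vertex {Y} {αY} vcY

    Above : Fin d → Set
    Above i = αX i ≡ true × αY i ≡ false

    above⇒moved : ∀ {i} → Above i → αX i ≢ αY i
    above⇒moved (αXi , αYi) αXi≡αYi = contradiction (trans (sym αXi) (trans αXi≡αYi αYi)) λ ()

    above⇒xonly : ∀ {i x} → P i x ≡ true → Above i → XOnly X Y x
    above⇒xonly px (αXi , αYi) = Equivalence.from (xonly⇔ X Y _)
      (trans (VX.F-on-component px) αXi , trans (VY.F-on-component px) αYi)

    xonly⇒inside : ∀ {x} → XOnly X Y x → (F I △ F J) x ≡ true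
    xonly⇒inside {x} xonly with Equivalence.to (xonly⇔ X Y x) xonly
    ... | inX , notY = differ⇒inside {X} {Y} {αX} {αY} vcX vcY λ e → contradiction (trans (sym inX) (trans e notY)) λ ()

    xonly-component : ∀ {x} → XOnly X Y x → ∃ λ i → P i x ≡ true × Above i
    xonly-component {x} xonly with Equivalence.to (xonly⇔ X Y x) xonly | cover x (xonly⇒inside xonly)
    ... | inX , notY | i , px =
      i , px , trans (sym (VX.F-on-component px)) inX , trans (sym (VY.F-on-component px)) notY

    above⇒rise : ∀ {i r c} → P i (r , c) ≡ true → Above i → X r < Y r
    above⇒rise {r = r} px above with above⇒xonly px above
    ... | τX≤c , c<τY = Equivalence.from (rise⇔ invX invY r) (≤-<-trans τX≤c c<τY)

    rise⇒above : ∀ {r} → X r < Y r → Σ (Fin d) λ i → Σ (Fin (n ∸ k)) λ c → P i (r , c) ≡ true × Above i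
    rise⇒above Xr<Yr with rising-cell invX invY Xr<Yr
    ... | c , xonly with xonly-component xonly
    ...   | i , px , above = i , c , px , above

    rows⇔components : (∃ λ r → X r < Y r) ⇔ ∃ Above
    rows⇔components = mk⇔
      (λ (r , Xr<Yr) → let (i , _ , _ , above) = rise⇒above Xr<Yr in i , above)
      (λ (i , above) → let (x , px) = nonempty i in proj₁ x , above⇒rise px above)

    agree⇒unmoved : ∀ {a b l r c} → AgreeBetween X Y a b → P l (r , c) ≡ true →
      a Fin.< r → r Fin.< b → αX l ≡ αY l
    agree⇒unmoved agree pz a<r r<b = trans (sym (VX.F-on-component pz))
      (trans (cong (_≤ᵇ _) (agree _ a<r r<b)) (VY.F-on-component pz))

    -- Under the hypotheses of crossing-threshold, the component of an X-only cell in
    -- a row ≤ a stays in rows ≤ a: it cannot cross the agreeing rows or bridge to row b.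
    stays-above : ∀ {a b i} → a Fin.< b → AgreeBetween X Y a b → τ Y a ≤ τ X b → Above i →
      ∀ {u z} → Path (F I △ F J) u z → P i u ≡ true → proj₁ u Fin.≤ a → proj₁ z Fin.≤ a
    stays-above {a} {b} {i} a<b agree τYa≤τXb above path =
      path-invariant (λ w → proj₁ w Fin.≤ a) preserved path
      where
      preserved : ∀ {u w} → P i u ≡ true → P i w ≡ true → Comparable u w →
        proj₁ u Fin.≤ a → proj₁ w Fin.≤ a
      preserved {u} {w} pu pw u~w u≤a with toℕ (proj₁ w) ≤? toℕ a
      ... | yes w≤a = w≤a
      ... | no  w≰a with toℕ (proj₁ w) <? toℕ b
      ...   | yes w<b = contradiction (above⇒xonly pw above) (agree⇒¬xonly {X = X} {Y} (agree _ (≰⇒> w≰a) w<b))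
      ...   | no  w≮b = contradiction u~w
              (no-bridge invX invY a<b τYa≤τXb (above⇒xonly pu above) (above⇒xonly pw above) u≤a (≮⇒≥ w≮b))

    rising-crossing⇒¬alternates : ∀ {a b} → a Fin.< b → AgreeBetween X Y a b →
      X a < Y a → Y a < X b → X b < Y b → ¬ Alternates αX αY
    rising-crossing⇒¬alternates {a} {b} a<b agree Xa<Ya Ya<Xb Xb<Yb alternates =
      by-components (rise⇒above Xa<Ya) (rise⇒above Xb<Yb)
      where
      by-components : (Σ (Fin d) λ i → Σ (Fin (n ∸ k)) λ c → P i (a , c) ≡ true × Above i) →
                      (Σ (Fin d) λ j → Σ (Fin (n ∸ k)) λ c → P j (b , c) ≡ true × Above j) → ⊥
      by-components (i , _ , pi , above-i) (j , _ , pj , above-j) with Finₚ.<-cmp i j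
      ... | tri< i<j _ _ = alternates i j i<j (above⇒moved above-i) (above⇒moved above-j) unmoved
              (trans (proj₁ above-i) (sym (proj₁ above-j)))
        where
        unmoved : ∀ l → i Fin.< l → l Fin.< j → αX l ≡ αY l
        unmoved l i<l l<j = let (_ , pz) = nonempty l in
          agree⇒unmoved agree pz (rows-ordered i<l pi pz) (rows-ordered l<j pz pj)
      ... | tri≈ _ i≡j _ = <⇒≱ a<b (stays-above a<b agree
              (crossing-threshold {X = X} {Y} invX invY a<b agree Ya<Xb) above-i (joined pi pj i≡j) pi ≤-refl)
      ... | tri> _ _ j<i = <-asym a<b (rows-ordered j<i pj pi)

    -- For components i < j above, with cells in rows a and b, τ Y a ≤ τ X b: otherwise
    -- the column τ X b would carry X-only cells of both rows, which are comparable.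
    threshold-gap : ∀ {i j a b cx cy} → i Fin.< j → P i (a , cx) ≡ true → P j (b , cy) ≡ true →
      Above i → Above j → τ Y a ≤ τ X b
    threshold-gap {i} {j} {a} {b} i<j pi pj above-i above-j with τ Y a ≤? τ X b
    ... | yes τYa≤τXb = τYa≤τXb
    ... | no  τYa≰τXb = contradiction (comparable⇒same pa pb a~b) (Finₚ.<⇒≢ i<j)
      where
      a<b : a Fin.< b
      a<b = rows-ordered i<j pi pj
      b-rises : τ X b < τ Y b
      b-rises = ≤-<-trans (proj₁ (above⇒xonly pj above-j)) (proj₂ (above⇒xonly pj above-j))
      cell-a = xonly-cell {X = X} invY a (τ-mono invX (<⇒≤ a<b)) (≰⇒> τYa≰τXb)
      cell-b = xonly-cell {X = X} invY b ≤-refl b-rises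
      pa : P i (a , proj₁ cell-a) ≡ true
      pa = absorb pi (xonly⇒inside (proj₂ (proj₂ cell-a))) (same-row-comparable refl)
      pb : P j (b , proj₁ cell-b) ≡ true
      pb = absorb pj (xonly⇒inside (proj₂ (proj₂ cell-b))) (same-row-comparable refl)
      a~b : Comparable (a , proj₁ cell-a) (b , proj₁ cell-b)
      a~b = inj₂ (<⇒≤ a<b , ≤-reflexive (trans (proj₁ (proj₂ cell-b)) (sym (proj₁ (proj₂ cell-a)))))

    rising-cross : ∀ {i j a b cx cy} → i Fin.< j → P i (a , cx) ≡ true → P j (b , cy) ≡ true →
      Above i → Above j → Cross (X a) (X b) (Y a) (Y b)
    rising-cross i<j pi pj above-i above-j = inj₁
      ( above⇒rise pi above-i
      , τ-order⇒value-order invX invY (rows-ordered i<j pi pj) (threshold-gap i<j pi pj above-i above-j)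
      , above⇒rise pj above-j )

    moved-between : ∀ {i j l x y z} → (∀ l → i Fin.< l → l Fin.< j → αX l ≡ αY l) →
      P i x ≡ true → P j y ≡ true → P l z ≡ true →
      proj₁ x Fin.< proj₁ z → proj₁ z Fin.< proj₁ y → αX l ≢ αY l → l ≡ i ⊎ l ≡ j
    moved-between {i} {j} {l} unmoved px py pz x<z z<y moved with Finₚ.<-cmp l i
    ... | tri< l<i _ _ = contradiction (rows-ordered l<i pz px) (<-asym x<z)
    ... | tri≈ _ l≡i _ = inj₁ l≡i
    ... | tri> _ _ i<l with Finₚ.<-cmp l j
    ...   | tri< l<j _ _ = contradiction (unmoved l i<l l<j) moved
    ...   | tri≈ _ l≡j _ = inj₂ l≡j
    ...   | tri> _ _ j<l = contradiction (rows-ordered j<l py pz) (<-asym z<y)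

    -- Descend on a bound f for the row distance between a cell
    -- of P i and a cell of P j: a separating row in between meets P i or P j.
    rising-components⇒¬noncrossing : ∀ {i j} → i Fin.< j → Above i → Above j →
      (∀ l → i Fin.< l → l Fin.< j → αX l ≡ αY l) → ¬ Noncrossing X Y
    rising-components⇒¬noncrossing {i} {j} i<j above-i above-j unmoved noncrossing =
      descend (toℕ (proj₁ y)) px py (m≤m+n (toℕ (proj₁ y)) (toℕ (proj₁ x)))
      where
      x = proj₁ (nonempty i)
      px = proj₂ (nonempty i)
      y = proj₁ (nonempty j)
      py = proj₂ (nonempty j)
      descend : ∀ f {x y} → P i x ≡ true → P j y ≡ true → toℕ (proj₁ y) ≤ f + toℕ (proj₁ x) → ⊥
      descend zero    px py bound = <⇒≱ (rows-ordered i<j px py) bound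
      descend (suc f) {x} {y} px py bound with agree-or-differ X Y (proj₁ x) (proj₁ y)
      ... | inj₁ agree = noncrossing _ _ (rows-ordered i<j px py) agree
                           (rising-cross i<j px py above-i above-j)
      ... | inj₂ (r , x<r , r<y , Xr≢Yr) with differing-cell invX invY Xr≢Yr
      ...   | c , FX≢FY with cover (r , c) (differ⇒inside {X} {Y} {αX} {αY} vcX vcY FX≢FY)
      ...     | l , pz with moved-between unmoved px py pz x<r r<y
                             (λ e → FX≢FY (trans (VX.F-on-component pz) (trans e (sym (VY.F-on-component pz)))))
      ...       | inj₁ refl = descend f pz py
                    (≤-trans bound (subst (_≤ f + toℕ r) (+-suc f (toℕ (proj₁ x))) (+-monoʳ-≤ f x<r)))
      ...       | inj₂ refl = descend f px pz (s≤s⁻¹ (≤-trans r<y bound))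

  nonnesting⇔comparable : ∀ {X Y αX αY} → InV k n X → InV k n Y →
    VertexCoords d I J X P αX → VertexCoords d I J Y P αY →
    Nonnesting X Y ⇔ (αX ≤α αY ⊎ αY ≤α αX)
  nonnesting⇔comparable {X} {Y} {αX} {αY} invX invY vcX vcY = mk⇔ nonnesting⇒ comparable⇒
    where
    module XY = Pair invX invY {αX} {αY} vcX vcY
    module YX = Pair invY invX {αY} {αX} vcY vcX

    nonnesting⇒ : Nonnesting X Y → αX ≤α αY ⊎ αY ≤α αX
    nonnesting⇒ nonnesting with ≤α-or-exceeds αX αY | ≤α-or-exceeds αY αX
    ... | inj₁ αX≤αY | _           = inj₁ αX≤αY
    ... | inj₂ _     | inj₁ αY≤αX = inj₂ αY≤αX
    ... | inj₂ up    | inj₂ down   = contradiction nonnesting (opposite-rows⇒nest invX invY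
          (proj₂ (Equivalence.from XY.rows⇔components up))
          (proj₂ (Equivalence.from YX.rows⇔components down)))

    comparable⇒ : αX ≤α αY ⊎ αY ≤α αX → Nonnesting X Y
    comparable⇒ (inj₁ αX≤αY) a b _ nest =
      ≤α⇒¬exceeds αX≤αY (proj₂ (Equivalence.to XY.rows⇔components (proj₁ (nest⇒opposite-rows nest))))
    comparable⇒ (inj₂ αY≤αX) a b _ nest =
      ≤α⇒¬exceeds αY≤αX (proj₂ (Equivalence.to YX.rows⇔components (proj₂ (nest⇒opposite-rows nest))))

  noncrossing⇔alternating : ∀ {X Y αX αY} → InV k n X → InV k n Y →
    VertexCoords d I J X P αX → VertexCoords d I J Y P αY →
    Noncrossing X Y ⇔ Alternates αX αY
  noncrossing⇔alternating {X} {Y} {αX} {αY} invX invY vcX vcY = mk⇔ noncrossing⇒ alternates⇒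
    where
    module XY = Pair invX invY {αX} {αY} vcX vcY
    module YX = Pair invY invX {αY} {αX} vcY vcX

    noncrossing⇒ : Noncrossing X Y → Alternates αX αY
    noncrossing⇒ noncrossing i j i<j i-moved j-moved unmoved αXi≡αXj with αX i Boolₚ.≟ true
    ... | yes αXi = XY.rising-components⇒¬noncrossing i<j
          (αXi , trans (differ⇒not i-moved) (cong not αXi))
          (αXj , trans (differ⇒not j-moved) (cong not αXj))
          unmoved noncrossing
      where αXj = trans (sym αXi≡αXj) αXi
    ... | no αXi≢true = YX.rising-components⇒¬noncrossing i<j
          (trans (differ⇒not i-moved) (cong not αXi) , αXi)
          (trans (differ⇒not j-moved) (cong not αXj) , αXj)
          (λ l i<l l<j → sym (unmoved l i<l l<j)) (noncrossing-sym noncrossing)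
      where
      αXi = Boolₚ.¬-not αXi≢true
      αXj = trans (sym αXi≡αXj) αXi

    alternates⇒ : Alternates αX αY → Noncrossing X Y
    alternates⇒ alternates a b a<b agree (inj₁ (Xa<Ya , Ya<Xb , Xb<Yb)) =
      XY.rising-crossing⇒¬alternates a<b agree Xa<Ya Ya<Xb Xb<Yb alternates
    alternates⇒ alternates a b a<b agree (inj₂ (Ya<Xa , Xa<Yb , Yb<Xb)) =
      YX.rising-crossing⇒¬alternates a<b (λ l a<l l<b → sym (agree l a<l l<b))
        Ya<Xa Xa<Yb Yb<Xb (alternates-sym alternates)

corollary4p14 : (k n : ℕ) → 1 ≤ k → k < n →
    (I J : Fin k → ℕ) → InV k n I → InV k n J →
    (d : ℕ) (P : Fin d → Subset k n) →
    IsComponents (F {k} {n} I △ F J) d P → IsOrderedComponents d P →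
    (X Y : Fin k → ℕ) → InV k n X → InV k n Y →
    (αX αY : Fin d → Bool) →
    VertexCoords d I J X P αX → VertexCoords d I J Y P αY →
    (Nonnesting X Y ⇔ (αX ≤α αY ⊎ αY ≤α αX))
    × (Noncrossing X Y ⇔ Alternates αX αY)
corollary4p14 k n _ _ I J _ _ d P comps ord X Y invX invY αX αY vcX vcY =
    nonnesting⇔comparable {X} {Y} {αX} {αY} invX invY vcX vcY
  , noncrossing⇔alternating {X} {Y} {αX} {αY} invX invY vcX vcY
  where open Face I J P comps ord
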